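{- Let $n\geq 2$ and let $K_n$ be the complete graph on $n$ vertices. Then $\chi_i^{c}(K_n)=2n-2$ if $n$ is even, and $\chi_i^{c}(K_n)=2n$ if $n$ is odd.
   Context: An incidence of a graph $G$ is a pair $(v,e)$ where $v$ is a vertex and $e$ an edge incident with $v$. For a vertex $w$, let $I(w)$ be the set of all incidences $(u,e)$ such that $e$ is incident with $w$. Two incidences conflict if both lie in $I(w)$ for some vertex $w$. A conflict-free incidence $k$-coloring assigns colors from a $k$-element set to the incidences so that conflicting incidences get distinct colors; $\chi^{c}_i(G)$ is the least such $k$. -}

module Defs where

open import Data.Nat using (ℕ; _<_)
open import Data.Fin using (Fin)
open import Data.Product using (Σ; ∃; _×_; _,_; proj₁; proj₂)
open import Data.Sum using (_⊎_)
open import Relation.Binary.PropositionalEquality using (_≡_; _≢_)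
open import Relation.Nullary using (¬_)
import Relation.Binary.PropositionalEquality as Eq

record Graph (n : ℕ) : Set₁ where
  field
    Adj    : Fin n → Fin n → Set
    sym    : ∀ {u v} → Adj u v → Adj v u
    irrefl : ∀ {u} → ¬ Adj u u

open Graph public

K : (n : ℕ) → Graph n
K n = record
  { Adj    = λ u v → u ≢ v
  ; sym    = λ p q → p (Eq.sym q)
  ; irrefl = λ p → p Eq.refl }

-- An incidence (v, e): e is the edge {v, u} with u adjacent to v
-- (in a simple graph an edge at v is determined by its other endpoint).
Incidence : ∀ {n} → Graph n → Set
Incidence {n} G = Σ (Fin n) λ v → Σ (Fin n) λ u → Adj G v u

vertex : ∀ {n} {G : Graph n} → Incidence G → Fin n
vertex (v , _ , _) = v

other : ∀ {n} {G : Graph n} → Incidence G → Fin n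
other (_ , u , _) = u

-- The underlying (vertex, edge) data of an incidence, used to compare
-- incidences (ignoring the adjacency proof).
key : ∀ {n} {G : Graph n} → Incidence G → Fin n × Fin n
key {G = G} i = vertex {G = G} i , other {G = G} i

-- (v, {v,u}) ∈ I(w)  iff  the edge {v,u} is incident with w.
InI : ∀ {n} {G : Graph n} → Fin n → Incidence G → Set
InI {G = G} w i = w ≡ vertex {G = G} i ⊎ w ≡ other {G = G} i

Conflict : ∀ {n} {G : Graph n} → Incidence G → Incidence G → Set
Conflict {n} {G} i j = ∃ λ (w : Fin n) → InI {G = G} w i × InI {G = G} w j

IsCFIncColoring : ∀ {n} (G : Graph n) (k : ℕ) → (Incidence G → Fin k) → Set
IsCFIncColoring G k c =
  ∀ (i j : Incidence G) → key {G = G} i ≢ key {G = G} j →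
    Conflict {G = G} i j → c i ≢ c j

CFIncColorable : ∀ {n} (G : Graph n) (k : ℕ) → Set
CFIncColorable G k = Σ (Incidence G → Fin k) (IsCFIncColoring G k)

χic≡ : ∀ {n} (G : Graph n) (m : ℕ) → Set
χic≡ G m = CFIncColorable G m × (∀ k → k < m → ¬ CFIncColorable G k)

module Submission where

-- Every I(w) consists of 2n-2 pairwise conflicting incidences, so 2n-2 colours are needed.  For
-- odd n more are needed: a colour occurring in every I(w) would pair each w with the other end of
-- its incidence of that colour, a fixed-point-free involution of an odd set.  So each colour misses
-- some I(w); with more than n colours two of them miss the same I(w), which forces 2 + (2n-2) colours.
-- Conversely, colouring (v, vu) by the colour of vu in a proper edge colouring with q colours,
-- together with the orientation of the pair v, u, is conflict-free.  K_n has such colourings with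
-- q = n, by v + u mod n, and for even n with q = n-1, by a + b mod n-1 away from one apex vertex and
-- by 2b mod n-1 on the edges at the apex.

open import Defs hiding (sym)
open import Data.Nat using (ℕ; zero; suc; _+_; _*_; _∸_; _≤_; _<_; z≤n; s≤s; NonZero)
open import Data.Nat.Properties
  using (+-comm; +-assoc; +-suc; +-identityʳ; *-suc; m∸n+n≡m; ≮⇒≥; <⇒≤; <⇒≱; <-asym; ≤-trans; +-monoˡ-≤)
open import Data.Nat.DivMod
  using (_%_; _mod_; %-distribˡ-+; %-distribˡ-*; [m+n]%n≡m%n; [m+kn]%n≡m%n; m%n%n≡m%n; m<n⇒m%n≡m)
open import Data.Nat.Divisibility using (_∣_; divides; _∣0; ∣-refl; ∣m∣n⇒∣m+n)
open import Data.Nat.Tactic.RingSolver using (solve-∀)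
open import Data.Fin using (Fin; zero; suc; toℕ; punchIn; punchOut; splitAt; join)
open import Data.Fin.Properties
  using (toℕ-injective; toℕ<n; toℕ-fromℕ<; suc-injective; punchIn-injective; punchInᵢ≢i;
         punchIn-punchOut; splitAt-join; join-splitAt; any?; ¬∀⟶∃¬; pigeonhole; injective⇒≤)
import Data.Fin.Properties as Fin
open import Data.Vec.Functional using (_∷_)
open import Data.Product using (Σ; ∃; _×_; _,_; proj₁; proj₂; swap)
open import Data.Product.Properties using (≡-dec)
open import Data.Sum using (_⊎_; inj₁; inj₂; reduce)
open import Data.Empty using (⊥; ⊥-elim)
open import Function using (_∘_)
open import Function.Definitions using (Injective)
open import Relation.Nullary using (¬_; yes; no)
open import Relation.Binary.PropositionalEquality

%-congʳ-+ : ∀ x {y z d} .{{_ : NonZero d}} → y % d ≡ z % d → (x + y) % d ≡ (x + z) % d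
%-congʳ-+ x {y} {z} {d} y≡z = begin
  (x + y) % d             ≡⟨ %-distribˡ-+ x y d ⟩
  (x % d + y % d) % d     ≡⟨ cong (λ r → (x % d + r) % d) y≡z ⟩
  (x % d + z % d) % d     ≡⟨ %-distribˡ-+ x z d ⟨
  (x + z) % d             ∎
  where open ≡-Reasoning

%-congʳ-* : ∀ x {y z d} .{{_ : NonZero d}} → y % d ≡ z % d → (x * y) % d ≡ (x * z) % d
%-congʳ-* x {y} {z} {d} y≡z = begin
  (x * y) % d             ≡⟨ %-distribˡ-* x y d ⟩
  (x % d * (y % d)) % d   ≡⟨ cong (λ r → (x % d * r) % d) y≡z ⟩
  (x % d * (z % d)) % d   ≡⟨ %-distribˡ-* x z d ⟨
  (x * z) % d             ∎
  where open ≡-Reasoning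

+-cancelˡ-% : ∀ {a b c m} .{{_ : NonZero m}} → a ≤ m → (a + b) % m ≡ (a + c) % m → b % m ≡ c % m
+-cancelˡ-% {a} {b} {c} {m} a≤m a+b≡a+c = begin
  b % m                      ≡⟨ [m+n]%n≡m%n b m ⟨
  (b + m) % m                ≡⟨ cong (_% m) (add-negation b) ⟩
  (m ∸ a + (a + b)) % m      ≡⟨ %-congʳ-+ (m ∸ a) a+b≡a+c ⟩
  (m ∸ a + (a + c)) % m      ≡⟨ cong (_% m) (add-negation c) ⟨
  (c + m) % m                ≡⟨ [m+n]%n≡m%n c m ⟩
  c % m                      ∎
  where
  open ≡-Reasoning
  add-negation : ∀ x → x + m ≡ m ∸ a + (a + x)
  add-negation x = begin
    x + m               ≡⟨ +-comm x m ⟩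
    m + x               ≡⟨ cong (_+ x) (m∸n+n≡m a≤m) ⟨
    m ∸ a + a + x       ≡⟨ +-assoc (m ∸ a) a x ⟩
    m ∸ a + (a + x)     ∎

-- h is an inverse of 2 modulo m.
halve-double : ∀ {a h m} .{{_ : NonZero m}} → suc m ≡ h * 2 → (h * ((a + a) % m)) % m ≡ a % m
halve-double {a} {h} {m} 1+m≡2h = begin
  (h * ((a + a) % m)) % m    ≡⟨ %-congʳ-* h {d = m} (m%n%n≡m%n (a + a) m) ⟩
  (h * (a + a)) % m          ≡⟨ cong (_% m) (reassociate a h) ⟩
  (a * (h * 2)) % m          ≡⟨ cong (λ r → (a * r) % m) 1+m≡2h ⟨
  (a * suc m) % m            ≡⟨ cong (_% m) (*-suc a m) ⟩
  (a + a * m) % m            ≡⟨ [m+kn]%n≡m%n a a m ⟩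
  a % m                      ∎
  where
  open ≡-Reasoning
  reassociate : ∀ a h → h * (a + a) ≡ a * (h * 2)
  reassociate = solve-∀

module _ {m : ℕ} .{{_ : NonZero m}} where

  infixl 6 _⊕_
  _⊕_ : Fin m → Fin m → Fin m
  a ⊕ b = (toℕ a + toℕ b) mod m

  toℕ-⊕ : ∀ a b → toℕ (a ⊕ b) ≡ (toℕ a + toℕ b) % m
  toℕ-⊕ a b = toℕ-fromℕ< _

  toℕ≡toℕ%m : ∀ (a : Fin m) → toℕ a ≡ toℕ a % m
  toℕ≡toℕ%m a = sym (m<n⇒m%n≡m (toℕ<n a))

  ⊕-comm : ∀ a b → a ⊕ b ≡ b ⊕ a
  ⊕-comm a b = cong (_mod m) (+-comm (toℕ a) (toℕ b))

  ⊕-cancelˡ : ∀ a {b c} → a ⊕ b ≡ a ⊕ c → b ≡ c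
  ⊕-cancelˡ a {b} {c} a⊕b≡a⊕c = toℕ-injective (begin
    toℕ b       ≡⟨ toℕ≡toℕ%m b ⟩
    toℕ b % m   ≡⟨ +-cancelˡ-% (<⇒≤ (toℕ<n a)) toℕ-sum ⟩
    toℕ c % m   ≡⟨ toℕ≡toℕ%m c ⟨
    toℕ c       ∎)
    where
    open ≡-Reasoning
    toℕ-sum : (toℕ a + toℕ b) % m ≡ (toℕ a + toℕ c) % m
    toℕ-sum = trans (sym (toℕ-⊕ a b)) (trans (cong toℕ a⊕b≡a⊕c) (toℕ-⊕ a c))

  ⊕-double-injective : 2 ∣ suc m → ∀ {a b} → a ⊕ a ≡ b ⊕ b → a ≡ b
  ⊕-double-injective (divides h 1+m≡2h) {a} {b} 2a≡2b = toℕ-injective (begin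
    toℕ a                                  ≡⟨ toℕ≡toℕ%m a ⟩
    toℕ a % m                              ≡⟨ halve-double {toℕ a} {h} 1+m≡2h ⟨
    (h * ((toℕ a + toℕ a) % m)) % m        ≡⟨ cong (λ r → (h * r) % m) toℕ-double ⟩
    (h * ((toℕ b + toℕ b) % m)) % m        ≡⟨ halve-double {toℕ b} {h} 1+m≡2h ⟩
    toℕ b % m                              ≡⟨ toℕ≡toℕ%m b ⟨
    toℕ b                                  ∎)
    where
    open ≡-Reasoning
    toℕ-double : (toℕ a + toℕ a) % m ≡ (toℕ b + toℕ b) % m
    toℕ-double = trans (sym (toℕ-⊕ a a)) (trans (cong toℕ 2a≡2b) (toℕ-⊕ b b))

module _ {m} (a : Fin (suc m)) where

  skip : Fin m → Fin (suc (suc m))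
  skip x = suc (punchIn a x)

  skip-injective : ∀ {x y} → skip x ≡ skip y → x ≡ y
  skip-injective {x} {y} skipx≡skipy = punchIn-injective a x y (suc-injective skipx≡skipy)

  unskip : (y : Fin (suc (suc m))) → y ≢ zero → y ≢ suc a → Fin m
  unskip zero    y≢0 _   = ⊥-elim (y≢0 refl)
  unskip (suc y) _   y≢a = punchOut {i = a} {j = y} (λ a≡y → y≢a (cong suc (sym a≡y)))

  skip-unskip : ∀ y y≢0 y≢a → skip (unskip y y≢0 y≢a) ≡ y
  skip-unskip zero    y≢0 _ = ⊥-elim (y≢0 refl)
  skip-unskip (suc y) _   _ = cong suc (punchIn-punchOut _)

-- Remove the orbit {0, f 0} and recurse on the remaining m points.
fixedPointFree-involution⇒even : ∀ {n} (f : Fin n → Fin n) →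
  (∀ x → f x ≢ x) → (∀ x → f (f x) ≡ x) → 2 ∣ n
fixedPointFree-involution⇒even {zero} f _ _ = 2 ∣0
fixedPointFree-involution⇒even {suc zero} f fixed-free _ with f zero in f0≡0
... | zero = ⊥-elim (fixed-free zero f0≡0)
fixedPointFree-involution⇒even {suc (suc m)} f fixed-free involutive with f zero in f0≡
... | zero  = ⊥-elim (fixed-free zero f0≡)
... | suc a = ∣m∣n⇒∣m+n (∣-refl {2}) (fixedPointFree-involution⇒even g g-fixed-free g-involutive)
  where
  f-injective : ∀ {x y} → f x ≡ f y → x ≡ y
  f-injective {x} {y} fx≡fy = trans (sym (involutive x)) (trans (cong f fx≡fy) (involutive y))

  f∘skip≢0 : ∀ x → f (skip a x) ≢ zero
  f∘skip≢0 x fx≡0 = punchInᵢ≢i a x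
    (suc-injective (trans (sym (involutive (skip a x))) (trans (cong f fx≡0) f0≡)))

  f∘skip≢a : ∀ x → f (skip a x) ≢ suc a
  f∘skip≢a x fx≡a with f-injective (trans fx≡a (sym f0≡))
  ... | ()

  g : Fin m → Fin m
  g x = unskip a (f (skip a x)) (f∘skip≢0 x) (f∘skip≢a x)

  skip∘g : ∀ x → skip a (g x) ≡ f (skip a x)
  skip∘g x = skip-unskip a _ _ _

  g-fixed-free : ∀ x → g x ≢ x
  g-fixed-free x gx≡x = fixed-free (skip a x) (trans (sym (skip∘g x)) (cong (skip a) gx≡x))

  g-involutive : ∀ x → g (g x) ≡ x
  g-involutive x = skip-injective a (begin
    skip a (g (g x))   ≡⟨ skip∘g (g x) ⟩
    f (skip a (g x))   ≡⟨ cong f (skip∘g x) ⟩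
    f (f (skip a x))   ≡⟨ involutive (skip a x) ⟩
    skip a x           ∎)
    where open ≡-Reasoning

module _ {n} {G : Graph n} where

  partner : ∀ {w} (i : Incidence G) → InI {G = G} w i → Fin n
  partner (_ , u , _) (inj₁ _) = u
  partner (v , _ , _) (inj₂ _) = v

  partner-∈ : ∀ {w} i (w∈i : InI {G = G} w i) → InI {G = G} (partner i w∈i) i
  partner-∈ _ (inj₁ _) = inj₂ refl
  partner-∈ _ (inj₂ _) = inj₁ refl

  partner-adjacent : ∀ {w} i (w∈i : InI {G = G} w i) → Adj G w (partner i w∈i)
  partner-adjacent (_ , _ , vu) (inj₁ refl) = vu
  partner-adjacent (_ , _ , vu) (inj₂ refl) = Graph.sym G vu

  partner-involutive : ∀ {w} i (w∈i : InI {G = G} w i) (x∈i : InI {G = G} (partner i w∈i) i) →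
                       partner i x∈i ≡ w
  partner-involutive (_ , _ , vu) (inj₁ refl) (inj₁ refl) = ⊥-elim (irrefl G vu)
  partner-involutive (_ , _ , _)  (inj₁ refl) (inj₂ refl) = refl
  partner-involutive (_ , _ , _)  (inj₂ refl) (inj₁ refl) = refl
  partner-involutive (_ , _ , vu) (inj₂ refl) (inj₂ refl) = ⊥-elim (irrefl G vu)

  partner-cong : ∀ {w} i j → key {G = G} i ≡ key {G = G} j →
                 (w∈i : InI {G = G} w i) (w∈j : InI {G = G} w j) → partner i w∈i ≡ partner j w∈j
  partner-cong (_ , _ , _)  (_ , _ , _) refl (inj₁ refl) (inj₁ refl) = refl
  partner-cong (_ , _ , vu) (_ , _ , _) refl (inj₁ refl) (inj₂ refl) = ⊥-elim (irrefl G vu)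
  partner-cong (_ , _ , vu) (_ , _ , _) refl (inj₂ refl) (inj₁ refl) = ⊥-elim (irrefl G vu)
  partner-cong (_ , _ , _)  (_ , _ , _) refl (inj₂ refl) (inj₂ refl) = refl

  module _ {k} {c : Incidence G → Fin k} (cf : IsCFIncColoring G k c) where

    sameColour⇒sameKey : ∀ i j → Conflict {G = G} i j → c i ≡ c j → key {G = G} i ≡ key {G = G} j
    sameColour⇒sameKey i j conflict ci≡cj with ≡-dec Fin._≟_ Fin._≟_ (key {G = G} i) (key {G = G} j)
    ... | yes i≡j = i≡j
    ... | no  i≢j = ⊥-elim (cf i j i≢j conflict ci≡cj)

    colourAtEveryVertex⇒even : (col : Fin k) →
      (∀ w → Σ (Incidence G) λ i → InI {G = G} w i × c i ≡ col) → 2 ∣ n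
    colourAtEveryVertex⇒even col witness =
      fixedPointFree-involution⇒even f f-fixed-free f-involutive
      where
      inc : Fin n → Incidence G
      inc w = proj₁ (witness w)

      w∈inc : ∀ w → InI {G = G} w (inc w)
      w∈inc w = proj₁ (proj₂ (witness w))

      f : Fin n → Fin n
      f w = partner (inc w) (w∈inc w)

      f-fixed-free : ∀ w → f w ≢ w
      f-fixed-free w fw≡w = irrefl G (subst (Adj G w) fw≡w (partner-adjacent (inc w) (w∈inc w)))

      -- inc w and inc (f w) both lie in I(f w) and have colour col, so they carry the same edge.
      f-involutive : ∀ w → f (f w) ≡ w
      f-involutive w = begin
        partner (inc (f w)) (w∈inc (f w))  ≡⟨ partner-cong _ _ same-edge fw∈inc-w (w∈inc (f w)) ⟨
        partner (inc w) fw∈inc-w           ≡⟨ partner-involutive (inc w) (w∈inc w) fw∈inc-w ⟩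
        w                                  ∎
        where
        open ≡-Reasoning
        fw∈inc-w : InI {G = G} (f w) (inc w)
        fw∈inc-w = partner-∈ (inc w) (w∈inc w)
        same-edge : key {G = G} (inc w) ≡ key {G = G} (inc (f w))
        same-edge = sameColour⇒sameKey (inc w) (inc (f w)) (f w , fw∈inc-w , w∈inc (f w))
                      (trans (proj₂ (proj₂ (witness w))) (sym (proj₂ (proj₂ (witness (f w))))))

∷-injective : ∀ {a} {A : Set a} {m} {x : A} {f : Fin m → A} →
              Injective _≡_ _≡_ f → (∀ j → f j ≢ x) → Injective _≡_ _≡_ (x ∷ f)
∷-injective f-injective x∉f {zero}  {zero}  _     = refl
∷-injective f-injective x∉f {zero}  {suc j} x≡fj  = ⊥-elim (x∉f j (sym x≡fj))
∷-injective f-injective x∉f {suc i} {zero}  fi≡x  = ⊥-elim (x∉f i fi≡x)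
∷-injective f-injective x∉f {suc i} {suc j} fi≡fj = cong suc (f-injective fi≡fj)

module _ {p : ℕ} where

  star⊎ : (w : Fin (suc p)) → Fin p ⊎ Fin p → Incidence (K (suc p))
  star⊎ w (inj₁ j) = w , punchIn w j , λ w≡ → punchInᵢ≢i w j (sym w≡)
  star⊎ w (inj₂ j) = punchIn w j , w , punchInᵢ≢i w j

  star : (w : Fin (suc p)) → Fin (p + p) → Incidence (K (suc p))
  star w = star⊎ w ∘ splitAt p

  star-∈ : ∀ w j → InI {G = K (suc p)} w (star w j)
  star-∈ w j with splitAt p j
  ... | inj₁ _ = inj₁ refl
  ... | inj₂ _ = inj₂ refl

  star⊎-key-injective : ∀ w {s t} → key {G = K (suc p)} (star⊎ w s) ≡ key {G = K (suc p)} (star⊎ w t) → s ≡ t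
  star⊎-key-injective w {inj₁ j} {inj₁ j′} e = cong inj₁ (punchIn-injective w j j′ (cong proj₂ e))
  star⊎-key-injective w {inj₁ j} {inj₂ j′} e = ⊥-elim (punchInᵢ≢i w j′ (sym (cong proj₁ e)))
  star⊎-key-injective w {inj₂ j} {inj₁ j′} e = ⊥-elim (punchInᵢ≢i w j (cong proj₁ e))
  star⊎-key-injective w {inj₂ j} {inj₂ j′} e = cong inj₂ (punchIn-injective w j j′ (cong proj₁ e))

  splitAt-injective : Injective _≡_ _≡_ (splitAt p {p})
  splitAt-injective {i} {j} e = trans (sym (join-splitAt p p i)) (trans (cong (join p p) e) (join-splitAt p p j))

  module _ {k} {c : Incidence (K (suc p)) → Fin k} (cf : IsCFIncColoring (K (suc p)) k c) where

    star-colour-injective : ∀ w → Injective _≡_ _≡_ (c ∘ star w)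
    star-colour-injective w {i} {j} same = splitAt-injective (star⊎-key-injective w
      (sameColour⇒sameKey {G = K (suc p)} cf (star w i) (star w j) (w , star-∈ w i , star-∈ w j) same))

    twice-degree≤colours : p + p ≤ k
    twice-degree≤colours = injective⇒≤ (star-colour-injective zero)

    OccursAt : Fin (suc p) → Fin k → Set
    OccursAt w col = ∃ λ j → c (star w j) ≡ col

    missedVertex : ¬ 2 ∣ suc p → (col : Fin k) → ∃ λ w → ¬ OccursAt w col
    missedVertex odd col = ¬∀⟶∃¬ (suc p) (λ w → OccursAt w col) (λ w → any? λ j → c (star w j) Fin.≟ col)
      λ occurs → odd (colourAtEveryVertex⇒even {G = K (suc p)} cf col λ w →
        star w (proj₁ (occurs w)) , star-∈ w (proj₁ (occurs w)) , proj₂ (occurs w))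

    -- Two colours missed at w, prepended to the 2p colours used in I(w), give 2p + 2 distinct colours.
    odd⇒twice-order≤colours : 2 ≤ p → ¬ 2 ∣ suc p → suc p + suc p ≤ k
    odd⇒twice-order≤colours 2≤p odd with pigeonhole 1+p<k (proj₁ ∘ missedVertex odd)
      where
      1+p<k : suc p < k
      1+p<k = ≤-trans (+-monoˡ-≤ p 2≤p) twice-degree≤colours
    ... | c₁ , c₂ , c₁<c₂ , same-vertex = subst (_≤ k) (sym (+-suc (suc p) p))
      (injective⇒≤ (∷-injective (∷-injective (star-colour-injective w) c₂∉star) c₁∉c₂∷star))
      where
      w : Fin (suc p)
      w = proj₁ (missedVertex odd c₁)
      c₁∉star : ∀ j → c (star w j) ≢ c₁
      c₁∉star j e = proj₂ (missedVertex odd c₁) (j , e)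
      c₂∉star : ∀ j → c (star w j) ≢ c₂
      c₂∉star j e = proj₂ (missedVertex odd c₂) (j , subst (λ v → c (star v j) ≡ c₂) same-vertex e)
      c₁∉c₂∷star : ∀ j → (c₂ ∷ c ∘ star w) j ≢ c₁
      c₁∉c₂∷star zero    = λ c₂≡c₁ → Fin.<⇒≢ c₁<c₂ (sym c₂≡c₁)
      c₁∉c₂∷star (suc j) = c₁∉star j

record ProperEdgeColouring {n} (G : Graph n) (q : ℕ) : Set where
  field
    colour           : Fin n → Fin n → Fin q
    colour-sym       : ∀ u v → colour u v ≡ colour v u
    colour-injective : ∀ {w x y} → Adj G w x → Adj G w y → colour w x ≡ colour w y → x ≡ y

orient : ∀ {n} {A : Set} → Fin n → Fin n → A → A ⊎ A
orient v u a with v Fin.<? u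
... | yes _ = inj₁ a
... | no  _ = inj₂ a

reduce-orient : ∀ {n} {A : Set} (v u : Fin n) (a : A) → reduce (orient v u a) ≡ a
reduce-orient v u a with v Fin.<? u
... | yes _ = refl
... | no  _ = refl

orient-reversed : ∀ {n} {A : Set} {v u v′ u′ : Fin n} {a b : A} →
                  (v , u) ≡ swap (v′ , u′) → orient v u a ≡ orient v′ u′ b → v ≡ u
orient-reversed {v = v} {u} refl same with v Fin.<? u | u Fin.<? v
... | yes v<u | yes u<v = ⊥-elim (<-asym v<u u<v)
... | yes _   | no  _   with () ← same
... | no  _   | yes _   with () ← same
... | no  v≮u | no  u≮v = Fin.≤-antisym (≮⇒≥ u≮v) (≮⇒≥ v≮u)

module _ {n} {G : Graph n} {q} (E : ProperEdgeColouring G q) where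
  open ProperEdgeColouring E

  sharedVertex⇒sameEdge : ∀ {w} i j → InI {G = G} w i → InI {G = G} w j →
    colour (vertex {G = G} i) (other {G = G} i) ≡ colour (vertex {G = G} j) (other {G = G} j) →
    key {G = G} i ≡ key {G = G} j ⊎ key {G = G} i ≡ swap (key {G = G} j)
  sharedVertex⇒sameEdge (v , u , vu) (_ , _ , v′u′) (inj₁ refl) (inj₁ refl) same =
    inj₁ (cong (v ,_) (colour-injective vu v′u′ same))
  sharedVertex⇒sameEdge (v , u , vu) (v′ , _ , v′u′) (inj₁ refl) (inj₂ refl) same =
    inj₂ (cong (v ,_) (colour-injective vu (Graph.sym G v′u′) (trans same (colour-sym v′ v))))
  sharedVertex⇒sameEdge (v , u , vu) (_ , u′ , v′u′) (inj₂ refl) (inj₁ refl) same =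
    inj₂ (cong (_, u) (colour-injective (Graph.sym G vu) v′u′ (trans (colour-sym u v) same)))
  sharedVertex⇒sameEdge (v , u , vu) (v′ , _ , v′u′) (inj₂ refl) (inj₂ refl) same =
    inj₁ (cong (_, u) (colour-injective (Graph.sym G vu) (Graph.sym G v′u′)
      (trans (colour-sym u v) (trans same (colour-sym v′ u)))))

  orientedColour : Incidence G → Fin (q + q)
  orientedColour (v , u , _) = join q q (orient v u (colour v u))

  orientedColour-cf : IsCFIncColoring G (q + q) orientedColour
  orientedColour-cf i@(v , u , vu) j@(v′ , u′ , _) key≢ (w , w∈i , w∈j) same =
    conclude (sharedVertex⇒sameEdge i j w∈i w∈j same-colour)
    where
    same-orientation : orient v u (colour v u) ≡ orient v′ u′ (colour v′ u′)
    same-orientation = trans (sym (splitAt-join q q _)) (trans (cong (splitAt q) same) (splitAt-join q q _))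

    same-colour : colour v u ≡ colour v′ u′
    same-colour = trans (sym (reduce-orient v u _))
      (trans (cong reduce same-orientation) (reduce-orient v′ u′ _))

    conclude : key {G = G} i ≡ key {G = G} j ⊎ key {G = G} i ≡ swap (key {G = G} j) → ⊥
    conclude (inj₁ key≡)     = key≢ key≡
    conclude (inj₂ key≡swap) = irrefl G (subst (Adj G v) (sym (orient-reversed key≡swap same-orientation)) vu)

  properEdgeColouring⇒colourable : CFIncColorable G (q + q)
  properEdgeColouring⇒colourable = orientedColour , orientedColour-cf

sumColouring : ∀ m .{{_ : NonZero m}} → ProperEdgeColouring (K m) m
sumColouring m = record
  { colour           = _⊕_
  ; colour-sym       = ⊕-comm
  ; colour-injective = λ {w} _ _ → ⊕-cancelˡ w
  }

module _ {k : ℕ} (even : 2 ∣ suc (suc k)) where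

  -- The colour of the loop at the apex 0 is junk.
  apexColour : Fin (suc (suc k)) → Fin (suc (suc k)) → Fin (suc k)
  apexColour zero    zero    = zero
  apexColour zero    (suc b) = b ⊕ b
  apexColour (suc a) zero    = a ⊕ a
  apexColour (suc a) (suc b) = a ⊕ b

  apexColour-sym : ∀ u v → apexColour u v ≡ apexColour v u
  apexColour-sym zero    zero    = refl
  apexColour-sym zero    (suc b) = refl
  apexColour-sym (suc a) zero    = refl
  apexColour-sym (suc a) (suc b) = ⊕-comm a b

  apexColour-injective : ∀ {w x y} → w ≢ x → w ≢ y → apexColour w x ≡ apexColour w y → x ≡ y
  apexColour-injective {zero}  {zero}  {_}     0≢0 _   _    = ⊥-elim (0≢0 refl)
  apexColour-injective {zero}  {suc _} {zero}  _   0≢0 _    = ⊥-elim (0≢0 refl)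
  apexColour-injective {zero}  {suc _} {suc _} _   _   same = cong suc (⊕-double-injective even same)
  apexColour-injective {suc _} {zero}  {zero}  _   _   _    = refl
  apexColour-injective {suc a} {zero}  {suc _} _   w≢y same = ⊥-elim (w≢y (cong suc (⊕-cancelˡ a same)))
  apexColour-injective {suc a} {suc _} {zero}  w≢x _   same = ⊥-elim (w≢x (cong suc (sym (⊕-cancelˡ a same))))
  apexColour-injective {suc a} {suc _} {suc _} _   _   same = cong suc (⊕-cancelˡ a same)

  apexColouring : ProperEdgeColouring (K (suc (suc k))) (suc k)
  apexColouring = record
    { colour           = apexColour
    ; colour-sym       = apexColour-sym
    ; colour-injective = apexColour-injective
    }

χic-K-even : ∀ k → 2 ∣ suc (suc k) → χic≡ (K (suc (suc k))) (suc k + suc k)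
χic-K-even k even = properEdgeColouring⇒colourable (apexColouring even)
                  , λ l l<2k (c , cf) → <⇒≱ l<2k (twice-degree≤colours {p = suc k} cf)

χic-K-odd : ∀ p → 2 ≤ p → ¬ 2 ∣ suc p → χic≡ (K (suc p)) (suc p + suc p)
χic-K-odd p 2≤p odd = properEdgeColouring⇒colourable (sumColouring (suc p))
                    , λ l l<2n (c , cf) → <⇒≱ l<2n (odd⇒twice-order≤colours {p = p} cf 2≤p odd)

2*m≡m+m : ∀ m → 2 * m ≡ m + m
2*m≡m+m m = cong (m +_) (+-identityʳ m)

2*[1+m]∸2≡m+m : ∀ m → 2 * suc m ∸ 2 ≡ m + m
2*[1+m]∸2≡m+m m = cong (_∸ 1) (trans (+-suc m (m + 0)) (cong (λ (x : ℕ) → suc (m + x)) (+-identityʳ m)))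

odd⇒3≤ : ∀ k → ¬ 2 ∣ suc (suc k) → 2 ≤ suc k
odd⇒3≤ zero    odd = ⊥-elim (odd ∣-refl)
odd⇒3≤ (suc _) _   = s≤s (s≤s z≤n)

theorem2p8 : (n : ℕ) → 2 ≤ n →
    ((2 ∣ n) → χic≡ (K n) (2 * n ∸ 2)) × (¬ (2 ∣ n) → χic≡ (K n) (2 * n))
theorem2p8 1 (s≤s ())
theorem2p8 (suc (suc k)) _ =
    (λ even → subst (χic≡ (K n)) (sym (2*[1+m]∸2≡m+m (suc k))) (χic-K-even k even))
  , (λ odd → subst (χic≡ (K n)) (sym (2*m≡m+m n)) (χic-K-odd (suc k) (odd⇒3≤ k odd) odd))
  where
  n : ℕ
  n = suc (suc k)
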